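{- Let $Q\in\mathbb{N}$, let $k\ge 1$ be an integer and let $i\in\mathbb{Z}$. If $\nu_2(\gamma_i)\ge 4k+1$, then $\nu_2(\gamma_{i+1})=\nu_2(\gamma_{i-1})=1$ and $\nu_2(\gamma_{i+j})=\nu_2(\gamma_{i-j})=2$ for all $2\le j\le k$.
   Context: For $Q\in\mathbb{N}$ let $\mathcal{F}_Q=\{a/q\in\mathbb{Q}: 1\le q\le Q,\ 0<a\le q,\ \gcd(a,q)=1\}$, of cardinality $N(Q)$, and write $\mathcal{F}_Q=\{\gamma_1,\dots,\gamma_{N(Q)}\}$ with $1/Q=\gamma_1<\gamma_2<\cdots<\gamma_{N(Q)}=1$. Extend this to a sequence indexed by all $i\in\mathbb{Z}$ by requiring $\gamma_{i+N(Q)}=\gamma_i+1$. For each $i$ write $\gamma_i=a_i/q_i$ with $\gcd(a_i,q_i)=1$ and $q_i>0$. The $2$-index of $\gamma_i$ (which depends on $Q$) is \[\nu_2(\gamma_i)=a_{i+1}q_{i-1}-a_{i-1}q_{i+1}.\] -}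

module Defs where

open import Data.Bool using (Bool)
open import Data.Nat as ℕ using (ℕ; zero; suc; _≡ᵇ_)
open import Data.Nat.GCD using (gcd)
open import Data.Integer as ℤ using (ℤ; +_; _/ℕ_; _%ℕ_)
open import Data.Rational as ℚ using (ℚ; ↥_; ↧_)
open import Data.Rational.Properties using (≤-decTotalOrder)
open import Data.List using (List; []; _∷_; concatMap; applyUpTo; filterᵇ; map; length)
import Data.List.Sort.MergeSort

open Data.List.Sort.MergeSort ≤-decTotalOrder using (sort)

fracsOfDen : ℕ → List ℚ
fracsOfDen zero = []
fracsOfDen (suc m) =
  map (λ a → (+ suc a) ℚ./ suc m)
      (filterᵇ (λ a → gcd (suc a) (suc m) ≡ᵇ 1) (applyUpTo (λ a → a) (suc m)))

-- The Farey fractions of order Q in (0,1], sorted increasingly: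
-- γ₁ < γ₂ < ... < γ_{N(Q)}  (list positions 0 .. N(Q)-1).
farey : ℕ → List ℚ
farey Q = sort (concatMap (λ q → fracsOfDen (suc q)) (applyUpTo (λ q → q) Q))

N : ℕ → ℕ
N Q = length (farey Q)

nth : List ℚ → ℕ → ℚ
nth []       _       = ℚ.0ℚ
nth (x ∷ xs) zero    = x
nth (x ∷ xs) (suc n) = nth xs n

-- periodic extension of a finite list x₁ < ... < x_N indexed by ℤ:
-- γ_i = x_{r+1} + t where i - 1 = t N + r, 0 ≤ r < N  (so γ_{i+N} = γ_i + 1).
-- (Empty list gives the constant 0; irrelevant since N(Q) ≥ 1 for Q ≥ 1.)
extend : List ℚ → ℤ → ℚ
extend []         i = ℚ.0ℚ
extend xs@(_ ∷ _) i =
  nth xs ((i ℤ.- ℤ.1ℤ) %ℕ length xs) ℚ.+ (((i ℤ.- ℤ.1ℤ) /ℕ length xs) ℚ./ 1)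

γ : ℕ → ℤ → ℚ
γ Q i = extend (farey Q) i

a : ℕ → ℤ → ℤ
a Q i = ↥ γ Q i

q : ℕ → ℤ → ℤ
q Q i = ↧ γ Q i

ν₂ : ℕ → ℤ → ℤ
ν₂ Q i = a Q (i ℤ.+ ℤ.1ℤ) ℤ.* q Q (i ℤ.- ℤ.1ℤ) ℤ.- a Q (i ℤ.- ℤ.1ℤ) ℤ.* q Q (i ℤ.+ ℤ.1ℤ)

module Submission where

-- Write q_m for the denominators of the extended Farey sequence
-- of order Q.  Consecutive terms a/q < a'/q' are Farey neighbours: a'q - aq' = 1
-- and q + q' > Q (FareyNeighbours, via Bézout and the bound ↧y ≥ ↧x + ↧z for y
-- strictly between neighbours x < z).  Combining the relations at m - 1 and m
-- gives ν₂(γ_m) q_m = q_{m-1} + q_{m+1}, so the 2-indices are the multipliers of a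
-- three-term recurrence of integers in (0, Q] with consecutive sums > Q
-- (FareySequence).  In such a "window recurrence" each multiplier is forced by the
-- position of the next term in the window (Q - q_m, Q] (WindowRecurrence).  If
-- ν₂(γ_i) ≥ 4k + 1 then 2 q_{i+1} > Q + (2k - 1) q_i, and induction shows
-- q_{i+1+t} = q_{i+1} - t q_i for t ≤ k, with multipliers 1, 2, ..., 2.  The same
-- analysis applies to the sequence read backwards, giving the statement at i - j.
-- The remaining modules establish the facts about the Farey list of Defs: its
-- members are exactly the reduced fractions in (0, 1] of denominator ≤ Q, sorted
-- (FareyList), and its periodic extension runs through consecutive Farey
-- fractions (Extension, using that integer translation preserves consecutiveness).
-- IntegerArithmetic supplies linear-inequality reasoning by explicit slacks.

module IntegerArithmetic where
  open import Data.Nat as ℕ using (ℕ; zero; suc)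
  open import Data.Integer
    using (ℤ; +_; -[1+_]; _+_; _-_; _*_; -_; _≤_; _<_; 0ℤ; 1ℤ; +≤+; +<+)
  open import Data.Integer.Properties
  open import Data.Integer.Tactic.RingSolver using (solve-∀)
  open import Data.Product using (_×_; _,_)
  open import Data.Empty using (⊥; ⊥-elim)
  open import Relation.Binary.PropositionalEquality

  0≤+ : ∀ {x y} → 0ℤ ≤ x → 0ℤ ≤ y → 0ℤ ≤ x + y
  0≤+ = +-mono-≤

  0≤* : ∀ {x y} → 0ℤ ≤ x → 0ℤ ≤ y → 0ℤ ≤ x * y
  0≤* {+ m} {+ n} _ _ rewrite sym (pos-* m n) = +≤+ ℕ.z≤n

  0≤ℕ : ∀ n → 0ℤ ≤ + n
  0≤ℕ n = +≤+ ℕ.z≤n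

  slack≤ : ∀ {a b} → a ≤ b → 0ℤ ≤ b - a
  slack≤ = i≤j⇒0≤j-i

  private
    suc-slack : ∀ a b → b - (1ℤ + a) ≡ b - a - 1ℤ
    suc-slack = solve-∀

  slack< : ∀ {a b} → a < b → 0ℤ ≤ b - a - 1ℤ
  slack< {a} {b} a<b = subst (0ℤ ≤_) (suc-slack a b) (i≤j⇒0≤j-i (i<j⇒suc[i]≤j a<b))

  -- Linear inequalities are proved by exhibiting their slack as an explicitly
  -- nonnegative expression e; the identity slack ≡ e is checked by the ring solver.
  ≤-by : ∀ {a b} e → b - a ≡ e → 0ℤ ≤ e → a ≤ b
  ≤-by e refl 0≤e = 0≤i-j⇒j≤i 0≤e

  <-by : ∀ {a b} e → b - a - 1ℤ ≡ e → 0ℤ ≤ e → a < b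
  <-by {a} {b} e eq 0≤e = suc[i]≤j⇒i<j (≤-by e (trans (suc-slack a b) eq) 0≤e)

  summand : ∀ {x P R} → x ≡ P + R → R ≡ x - P
  summand {x} {P} {R} x≡ = trans (cancel P R) (cong (_- P) (sym x≡))
    where cancel : ∀ P R → R ≡ P + R - P
          cancel = solve-∀

  0≤-≢-1 : ∀ {e} → 0ℤ ≤ e → e ≡ -[1+ 0 ] → ⊥
  0≤-≢-1 (+≤+ _) ()

  -- Two integers in a window (Q - S, Q] of length S which differ by a multiple
  -- d S of S coincide, i.e. d = 0: for d ≠ 0 the two window slacks together with
  -- (∣d∣ - 1) S would add up to -1.
  window-unique : ∀ {Q S R R′ d} → R ≤ Q → Q < S + R → R′ ≤ Q → Q < S + R′ →
                  0ℤ ≤ S → R ≡ R′ + d * S → d ≡ 0ℤ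
  window-unique {d = + zero} _ _ _ _ _ _ = refl
  window-unique {Q} {S} {R′ = R′} {d = + suc m} R≤Q _ _ Q<S+R′ 0≤S refl =
    ⊥-elim (0≤-≢-1 (0≤+ (0≤+ (slack< Q<S+R′) (slack≤ R≤Q)) (0≤* (0≤ℕ m) 0≤S))
                    (identity Q S R′ (+ m)))
    where identity : ∀ Q S R′ M → S + R′ - Q - 1ℤ + (Q - (R′ + (1ℤ + M) * S)) + M * S ≡ -[1+ 0 ]
          identity = solve-∀
  window-unique {Q} {S} {R′ = R′} {d = -[1+ m ]} _ Q<S+R R′≤Q _ 0≤S refl =
    ⊥-elim (0≤-≢-1 (0≤+ (0≤+ (slack< Q<S+R) (slack≤ R′≤Q)) (0≤* (0≤ℕ m) 0≤S))
                    (identity Q S R′ (+ m)))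
    where identity : ∀ Q S R′ M → S + (R′ + (- (1ℤ + M)) * S) - Q - 1ℤ + (Q - R′) + M * S ≡ -[1+ 0 ]
          identity = solve-∀

  -- Division with remainder by N is unique: remainders in [0, N) lie in the window
  -- (-1, N - 1] of length N, so two decompositions r + t N = r′ + t′ N agree.
  divmod-unique : ∀ N {r r′ t t′} → r ℕ.< N → r′ ℕ.< N →
                  + r + t * + N ≡ + r′ + t′ * + N → (r ≡ r′) × (t ≡ t′)
  divmod-unique N {r} {r′} {t} {t′} r<N r′<N eq = +-injective r≡r′ , t≡t′
    where
    below-top : ∀ {s} → s ℕ.< N → + s ≤ + N - 1ℤ
    below-top {s} s<N = ≤-by _ (identity (+ N) (+ s)) (slack< (+<+ s<N))
      where identity : ∀ N s → N - 1ℤ - s ≡ N - s - 1ℤ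
            identity = solve-∀
    above-bottom : ∀ s → + N - 1ℤ < + N + + s
    above-bottom s = <-by _ (identity (+ N) (+ s)) (0≤ℕ s)
      where identity : ∀ N s → N + s - (N - 1ℤ) - 1ℤ ≡ s
            identity = solve-∀
    shift : ∀ r r′ t t′ N → r + t * N ≡ r′ + t′ * N → r ≡ r′ + (t′ - t) * N
    shift r r′ t t′ N eq = trans (identity r t N) (trans (cong (_- t * N) eq) (regroup r′ t t′ N))
      where identity : ∀ r t N → r ≡ r + t * N - t * N
            identity = solve-∀
            regroup : ∀ r′ t t′ N → r′ + t′ * N - t * N ≡ r′ + (t′ - t) * N
            regroup = solve-∀
    t′-t≡0 : t′ - t ≡ 0ℤ
    t′-t≡0 = window-unique (below-top r<N) (above-bottom r) (below-top r′<N) (above-bottom r′) (0≤ℕ N)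
                           (shift (+ r) (+ r′) t t′ (+ N) eq)
    t≡t′ : t ≡ t′
    t≡t′ = sym (i-j≡0⇒i≡j t′ t t′-t≡0)
    r≡r′ : + r ≡ + r′
    r≡r′ = trans (shift (+ r) (+ r′) t t′ (+ N) eq)
                 (trans (cong (λ d → + r′ + d * + N) t′-t≡0) (+-identityʳ (+ r′)))

module WindowRecurrence where
  open IntegerArithmetic
  open import Data.Nat as ℕ using (ℕ; zero; suc; s≤s)
  import Data.Nat.Properties as ℕP
  open import Data.Integer
    using (ℤ; +_; _+_; _-_; _*_; -_; _≤_; _<_; 0ℤ; 1ℤ; +≤+; _≤?_)
  open import Data.Integer.Properties as ℤP using (i-j≡0⇒i≡j; ≰⇒>)
  open import Data.Integer.Tactic.RingSolver using (solve-∀)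
  open import Data.Product using (_×_; _,_; proj₁; proj₂)
  open import Relation.Nullary using (yes; no)
  open import Relation.Binary.PropositionalEquality

  window-multiplier : ∀ {Q S P R ν c} → 0ℤ ≤ S → R ≤ Q → Q < S + R →
                      c * S - P ≤ Q → Q < S + (c * S - P) → ν * S ≡ P + R → ν ≡ c
  window-multiplier {Q} {S} {P} {R} {ν} {c} 0≤S R≤Q Q<S+R c≤Q Q<c ν≡ =
    i-j≡0⇒i≡j ν c (window-unique R≤Q Q<S+R c≤Q Q<c 0≤S
      (trans (summand ν≡) (regroup ν c S P)))
    where regroup : ∀ ν c S P → ν * S - P ≡ (c * S - P) + (ν - c) * S
          regroup = solve-∀

  -- Sequences of denominators s in (0, Q] with consecutive sums exceeding Q and
  -- linked by the three-term recurrence n (j+1) s (j+1) = s j + s (j+2).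
  -- Consecutive Farey denominators, read in either direction, form such a sequence.
  record IsRecurrence (Q : ℤ) (s n : ℕ → ℤ) : Set where
    field
      positive   : ∀ j → 1ℤ ≤ s j
      bounded    : ∀ j → s j ≤ Q
      adjacent   : ∀ j → Q < s j + s (suc j)
      recurrence : ∀ j → n (suc j) * s (suc j) ≡ s j + s (suc (suc j))

  module _ {Q : ℤ} {s n : ℕ → ℤ} (R : IsRecurrence Q s n) where
    open IsRecurrence R

    nonnegative : ∀ j → 0ℤ ≤ s j
    nonnegative j = ℤP.≤-trans (+≤+ ℕ.z≤n) (positive j)

    next-term : ∀ j c → c * s (suc j) - s j ≤ Q → Q < s (suc j) + (c * s (suc j) - s j) →
                (n (suc j) ≡ c) × (s (suc (suc j)) ≡ c * s (suc j) - s j)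
    next-term j c c≤Q Q<c = n≡c , s≡
      where
      n≡c : n (suc j) ≡ c
      n≡c = window-multiplier (nonnegative (suc j))
              (bounded (suc (suc j))) (adjacent (suc j)) c≤Q Q<c (recurrence j)
      s≡ : s (suc (suc j)) ≡ c * s (suc j) - s j
      s≡ = summand (subst (λ m → m * s (suc j) ≡ _) n≡c (recurrence j))

  large-multiplier-gap : ∀ {Q q s₀ s₂ ν K} → 0ℤ ≤ q → s₀ ≤ Q → Q < q + s₂ →
                         + 4 * K + 1ℤ ≤ ν → ν * q ≡ s₀ + s₂ →
                         Q + (+ 2 * K - 1ℤ) * q < + 2 * s₂
  large-multiplier-gap {Q} {q} {s₀} {s₂} {ν} {K} 0≤q s₀≤Q Q<q+s₂ ν≥ ν≡
    with (+ 2 * K + 1ℤ) * q ≤? Q + 1ℤ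
  ... | yes small-q = <-by _ (small Q q s₂ K) (0≤+ (0≤* (0≤ℕ 2) (slack< Q<q+s₂)) (slack≤ small-q))
    where small : ∀ Q q s₂ K → + 2 * s₂ - (Q + (+ 2 * K - 1ℤ) * q) - 1ℤ ≡
                                 + 2 * (q + s₂ - Q - 1ℤ) + (Q + 1ℤ - (+ 2 * K + 1ℤ) * q)
          small = solve-∀
  ... | no large-q = <-by _ (large (summand ν≡))
                          (0≤+ (0≤+ (0≤+ (0≤* (0≤ℕ 2) (0≤* (slack≤ ν≥) 0≤q)) (0≤* (0≤ℕ 2) (slack≤ s₀≤Q)))
                                    (0≤* (0≤ℕ 3) (slack< (≰⇒> large-q))))
                               (0≤ℕ 5))
    where
    large : s₂ ≡ ν * q - s₀ →
            + 2 * s₂ - (Q + (+ 2 * K - 1ℤ) * q) - 1ℤ ≡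
            + 2 * ((ν - (+ 4 * K + 1ℤ)) * q) + + 2 * (Q - s₀)
              + + 3 * ((+ 2 * K + 1ℤ) * q - (Q + 1ℤ) - 1ℤ) + + 5
    large refl = identity Q q s₀ ν K
      where identity : ∀ Q q s₀ ν K →
                       + 2 * (ν * q - s₀) - (Q + (+ 2 * K - 1ℤ) * q) - 1ℤ ≡
                       + 2 * ((ν - (+ 4 * K + 1ℤ)) * q) + + 2 * (Q - s₀)
                         + + 3 * ((+ 2 * K + 1ℤ) * q - (Q + 1ℤ) - 1ℤ) + + 5
            identity = solve-∀

  module LargeMultiplier {Q : ℤ} {s n : ℕ → ℤ} (R : IsRecurrence Q s n)
                         (k : ℕ) (1≤k : 1 ℕ.≤ k) (ν≥ : + 4 * + k + 1ℤ ≤ n 1) where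
    open IsRecurrence R

    K = + k

    0≤s₁ : 0ℤ ≤ s 1
    0≤s₁ = nonnegative R 1

    -- The key inequality, which keeps every later term inside its window.
    gap : Q + (+ 2 * K - 1ℤ) * s 1 < + 2 * s 2
    gap = large-multiplier-gap {K = K} 0≤s₁ (bounded 0) (adjacent 1) ν≥ (recurrence 0)

    first-step : (n 2 ≡ 1ℤ) × (s 3 ≡ 1ℤ * s 2 - s 1)
    first-step = next-term R 1 1ℤ below above
      where
      below : 1ℤ * s 2 - s 1 ≤ Q
      below = ≤-by _ (slack Q (s 1) (s 2)) (0≤+ (slack≤ (bounded 2)) 0≤s₁)
        where slack : ∀ Q q s₂ → Q - (1ℤ * s₂ - q) ≡ (Q - s₂) + q
              slack = solve-∀
      above : Q < s 2 + (1ℤ * s 2 - s 1)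
      above = <-by _ (slack Q (s 1) (s 2) K)
                   (0≤+ (slack< gap) (0≤* (0≤ℕ 2) (0≤* (slack≤ (+≤+ 1≤k)) 0≤s₁)))
        where slack : ∀ Q q s₂ K → s₂ + (1ℤ * s₂ - q) - Q - 1ℤ ≡
                                   (+ 2 * s₂ - (Q + (+ 2 * K - 1ℤ) * q) - 1ℤ) + + 2 * ((K - 1ℤ) * q)
              slack = solve-∀

    Progression : ℕ → Set
    Progression t = (s (2 ℕ.+ t) ≡ s 2 - + t * s 1) × (s (3 ℕ.+ t) ≡ s 2 - (1ℤ + + t) * s 1)

    later-step : ∀ t → 2 ℕ.+ t ℕ.≤ k → Progression t →
                 (n (3 ℕ.+ t) ≡ + 2) × (s (4 ℕ.+ t) ≡ s 2 - (+ 2 + + t) * s 1)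
    later-step t 2+t≤k (sP , sS) = proj₁ step , next
      where
      below : + 2 * s (3 ℕ.+ t) - s (2 ℕ.+ t) ≤ Q
      below = subst₂ (λ S P → + 2 * S - P ≤ Q) (sym sS) (sym sP)
                (≤-by _ (slack Q (s 1) (s 2) (+ t))
                   (0≤+ (slack≤ (bounded 2)) (0≤* (0≤ℕ (2 ℕ.+ t)) 0≤s₁)))
        where slack : ∀ Q q s₂ T → Q - (+ 2 * (s₂ - (1ℤ + T) * q) - (s₂ - T * q)) ≡
                                   (Q - s₂) + (+ 2 + T) * q
              slack = solve-∀
      above : Q < s (3 ℕ.+ t) + (+ 2 * s (3 ℕ.+ t) - s (2 ℕ.+ t))
      above = subst₂ (λ S P → Q < S + (+ 2 * S - P)) (sym sS) (sym sP)
                (<-by _ (slack Q (s 1) (s 2) (+ t) K)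
                   (0≤+ (slack< gap) (0≤* (0≤ℕ 2) (0≤* (slack≤ (+≤+ 2+t≤k)) 0≤s₁))))
        where slack : ∀ Q q s₂ T K →
                      (s₂ - (1ℤ + T) * q) + (+ 2 * (s₂ - (1ℤ + T) * q) - (s₂ - T * q)) - Q - 1ℤ ≡
                      (+ 2 * s₂ - (Q + (+ 2 * K - 1ℤ) * q) - 1ℤ) + + 2 * ((K - (+ 2 + T)) * q)
              slack = solve-∀
      step = next-term R (2 ℕ.+ t) (+ 2) below above
      combine : ∀ s₂ q T → + 2 * (s₂ - (1ℤ + T) * q) - (s₂ - T * q) ≡ s₂ - (+ 2 + T) * q
      combine = solve-∀
      next : s (4 ℕ.+ t) ≡ s 2 - (+ 2 + + t) * s 1
      next = begin
        s (4 ℕ.+ t)                                         ≡⟨ proj₂ step ⟩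
        + 2 * s (3 ℕ.+ t) - s (2 ℕ.+ t)                     ≡⟨ cong₂ (λ S P → + 2 * S - P) sS sP ⟩
        + 2 * (s 2 - (1ℤ + + t) * s 1) - (s 2 - + t * s 1)  ≡⟨ combine (s 2) (s 1) (+ t) ⟩
        s 2 - (+ 2 + + t) * s 1                             ∎
        where open ≡-Reasoning

    progression : ∀ t → suc t ℕ.≤ k → Progression t
    progression zero    _     = start (s 2) (s 1) , trans (proj₂ first-step) (one (s 2) (s 1))
      where start : ∀ s₂ q → s₂ ≡ s₂ - + 0 * q
            start = solve-∀
            one : ∀ s₂ q → 1ℤ * s₂ - q ≡ s₂ - + 1 * q
            one = solve-∀
    progression (suc t) 2+t≤k = proj₂ previous , proj₂ (later-step t 2+t≤k previous)
      where previous = progression t (ℕP.<⇒≤ 2+t≤k)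

    multipliers : (n 2 ≡ 1ℤ) × (∀ j → 2 ℕ.≤ j → j ℕ.≤ k → n (suc j) ≡ + 2)
    multipliers = proj₁ first-step , doubled
      where doubled : ∀ j → 2 ℕ.≤ j → j ℕ.≤ k → n (suc j) ≡ + 2
            doubled (suc zero)    (s≤s ()) _
            doubled (suc (suc t)) _        2+t≤k =
              proj₁ (later-step t 2+t≤k (progression t (ℕP.<⇒≤ 2+t≤k)))

module Fractions where
  open import Data.Nat as ℕ using (ℕ; suc)
  import Data.Nat.Divisibility as ℕD
  import Data.Nat.Coprimality as C
  open import Data.Integer as ℤ using (ℤ; +_; -[1+_]; ∣_∣; +≤+; 0ℤ; 1ℤ)
  import Data.Integer.Properties as ℤP
  open import Data.Integer.Divisibility.Signed using (divides; ∣⇒∣ᵤ)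
  open import Data.Rational as ℚ using (ℚ; mkℚ; ↧_; _+_; _-_; -_; _<_)
  import Data.Rational.Properties as ℚP
  import Data.Rational.Unnormalised as ℚᵘ
  import Data.Rational.Unnormalised.Properties as ℚᵘP
  open import Data.Integer.Tactic.RingSolver using (solve-∀)
  open import Data.Empty using (⊥)
  open import Relation.Binary.PropositionalEquality

  integer : ℤ → ℚ
  integer t = mkℚ t 0 (C.sym (C.1-coprimeTo ∣ t ∣))

  /1≡integer : ∀ t → t ℚ./ 1 ≡ integer t
  /1≡integer (+ m)    = ℚP.normalize-coprime (C.sym (C.1-coprimeTo m))
  /1≡integer -[1+ m ] = cong ℚ.-_ (ℚP.normalize-coprime (C.sym (C.1-coprimeTo (suc m))))

  ↧-∣⇒≤ : ∀ {p q : ℚ} {g : ℤ} → ↧ p ℤ.* g ≡ ↧ q ℤ.* 1ℤ → ↧ p ℤ.≤ ↧ q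
  ↧-∣⇒≤ {p} {q} {g} eq = +≤+ (ℕD.∣⇒≤ (∣⇒∣ᵤ (divides g ↧q≡)))
    where ↧q≡ : ↧ q ≡ g ℤ.* ↧ p
          ↧q≡ = trans (sym (ℤP.*-identityʳ (↧ q))) (trans (sym eq) (ℤP.*-comm (↧ p) g))

  -- Adding an integer w (↧ w = 1) does not increase the reduced denominator: the
  -- unreduced denominator of y + w is ↧ y · 1, and reduction only divides it.
  ↧-+integral : ∀ y w → ↧ w ≡ 1ℤ → ↧ (y + w) ℤ.≤ ↧ y
  ↧-+integral y w ↧w≡1 = ↧-∣⇒≤ {y + w} {y} (trans (ℚP.↧-+ y w) (cong (↧ y ℤ.*_) ↧w≡1))

  integer-+ : ∀ a b → integer (a ℤ.+ b) ≡ integer a + integer b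
  integer-+ a b = ℚP.toℚᵘ-injective
    (ℚᵘP.≃-trans (ℚᵘ.*≡* (identity a b)) (ℚᵘP.≃-sym (ℚP.toℚᵘ-homo-+ (integer a) (integer b))))
    where identity : ∀ a b → (a ℤ.+ b) ℤ.* 1ℤ ≡ (a ℤ.* 1ℤ ℤ.+ b ℤ.* 1ℤ) ℤ.* 1ℤ
          identity = solve-∀

  +-cancelʳ : ∀ u w → u + w - w ≡ u
  +-cancelʳ u w = //-rightDividesʳ w u
    where open import Algebra.Properties.Group ℚP.+-0-group using (//-rightDividesʳ)

  record Consecutive (Q : ℕ) (x y : ℚ) : Set where
    field
      increasing : x < y
      no-between : ∀ z → ↧ z ℤ.≤ + Q → x < z → z < y → ⊥

  -- Translating by an integer preserves consecutiveness, since it preserves the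
  -- order and does not increase denominators in either direction.
  consecutive-+integer : ∀ {Q x y} t → Consecutive Q x y →
                         Consecutive Q (x + integer t) (y + integer t)
  consecutive-+integer {Q} {x} {y} t c = record
    { increasing = ℚP.+-monoˡ-< (integer t) increasing
    ; no-between = λ z ↧z≤Q x+t<z z<y+t →
        no-between (z - integer t) (ℤP.≤-trans (↧-+integral z (- integer t) (ℚP.↧-neg (integer t))) ↧z≤Q)
                   (subst (_< z - integer t) (+-cancelʳ x (integer t)) (ℚP.+-monoˡ-< (- integer t) x+t<z))
                   (subst (z - integer t <_) (+-cancelʳ y (integer t)) (ℚP.+-monoˡ-< (- integer t) z<y+t))
    }
    where open Consecutive c

  0≤↧ : ∀ p → 0ℤ ℤ.≤ ↧ p
  0≤↧ p = +≤+ ℕ.z≤n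

module FareyNeighbours where
  open IntegerArithmetic
  open Fractions
  open import Data.Nat as ℕ using (ℕ; suc; NonZero)
  import Data.Nat.Properties as ℕP
  import Data.Nat.Divisibility as ℕD
  open import Data.Nat.GCD using (module Bézout)
  open import Data.Nat.Coprimality as C using (Coprime)
  open import Data.Integer
    using (ℤ; +_; -[1+_]; ∣_∣; _+_; _-_; _*_; -_; _≤_; _<_; 0ℤ; 1ℤ; +≤+; +<+)
  import Data.Integer.Properties as ℤP
  open import Data.Integer.DivMod using (_%ℕ_; _/ℕ_; n%ℕd<d; a≡a%ℕn+[a/ℕn]*n)
  open import Data.Integer.Divisibility.Signed using (∣ᵤ⇒∣; ∣⇒∣ᵤ; ∣m∣n⇒∣m-n; ∣m⇒∣m*n; ∣n⇒∣m*n)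
  open import Data.Integer.Tactic.RingSolver using (solve-∀)
  open import Data.Rational as ℚ using (ℚ; mkℚ; ↥_; ↧_; *<*)
  import Data.Rational.Properties as ℚP
  open import Data.Product using (Σ; ∃₂; _×_; _,_)
  open import Data.Empty using (⊥)
  open import Relation.Binary.PropositionalEquality

  lift : ∀ x y m n → 1 ℕ.+ y ℕ.* n ≡ x ℕ.* m → 1ℤ + + y * + n ≡ + x * + m
  lift x y m n eq = begin
    1ℤ + + y * + n      ≡⟨ cong (λ u → 1ℤ + u) (sym (ℤP.pos-* y n)) ⟩
    + (1 ℕ.+ y ℕ.* n)   ≡⟨ cong +_ eq ⟩
    + (x ℕ.* m)         ≡⟨ ℤP.pos-* x m ⟩
    + x * + m           ∎
    where open ≡-Reasoning

  bezout : ∀ a n → Coprime ∣ a ∣ n → ∃₂ λ X Y → X * + n - a * Y ≡ 1ℤ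
  bezout (+ m) n cop with Bézout.identity (C.coprime⇒GCD≡1 cop)
  ... | Bézout.+- x y eq = - + y , - + x , (begin
    - + y * + n - + m * - + x          ≡⟨ rearrange (+ x) (+ y) (+ m) (+ n) ⟩
    + x * + m - + y * + n              ≡⟨ cong (_- + y * + n) (sym (lift x y m n eq)) ⟩
    1ℤ + + y * + n - + y * + n         ≡⟨ cancel (+ y * + n) ⟩
    1ℤ                                 ∎)
    where
    open ≡-Reasoning
    rearrange : ∀ x y m n → - y * n - m * - x ≡ x * m - y * n
    rearrange = solve-∀
    cancel : ∀ u → 1ℤ + u - u ≡ 1ℤ
    cancel = solve-∀
  ... | Bézout.-+ x y eq = + y , + x , (begin
    + y * + n - + m * + x              ≡⟨ cong (_- + m * + x) (sym (lift y x n m eq)) ⟩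
    1ℤ + + x * + m - + m * + x         ≡⟨ cancel (+ x) (+ m) ⟩
    1ℤ                                 ∎)
    where
    open ≡-Reasoning
    cancel : ∀ x m → 1ℤ + x * m - m * x ≡ 1ℤ
    cancel = solve-∀
  bezout -[1+ m ] n cop with bezout (+ suc m) n cop
  ... | X , Y , eq = X , - Y , trans (rearrange X Y (+ suc m) (+ n)) eq
    where rearrange : ∀ X Y m n → X * n - (- m) * (- Y) ≡ X * n - m * Y
          rearrange = solve-∀

  bezout⇒coprime : ∀ X d u v → X * u - v * d ≡ 1ℤ → Coprime ∣ X ∣ ∣ d ∣
  bezout⇒coprime X d u v eq {i} (i∣X , i∣d) = ℕD.∣1⇒≡1 (subst (λ e → i ℕD.∣ ∣ e ∣) eq i∣rel)
    where i∣rel : i ℕD.∣ ∣ X * u - v * d ∣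
          i∣rel = ∣⇒∣ᵤ (∣m∣n⇒∣m-n (∣m⇒∣m*n u (∣ᵤ⇒∣ {+ i} {X} i∣X)) (∣n⇒∣m*n v (∣ᵤ⇒∣ {+ i} {d} i∣d)))

  window-representative : ∀ Y n Q .{{_ : NonZero n}} → n ℕ.≤ Q →
    Σ ℕ λ w → Σ ℤ λ t → (+ suc w ≡ Y + t * + n) × (suc w ℕ.≤ Q) × (Q ℕ.< suc w ℕ.+ n)
  window-representative Y n Q n≤Q = w , t , representative , subst (suc w ℕ.≤_) w+r (ℕP.m≤m+n (suc w) r) , Q<
    where
    D = + Q - Y
    r = D %ℕ n
    t = D /ℕ n
    r<Q : r ℕ.< Q
    r<Q = ℕP.<-≤-trans (n%ℕd<d D n) n≤Q
    w = Q ℕ.∸ suc r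
    w+r : suc w ℕ.+ r ≡ Q
    w+r = trans (sym (ℕP.+-suc w r)) (ℕP.m∸n+n≡m r<Q)
    Q< : Q ℕ.< suc w ℕ.+ n
    Q< = subst (ℕ._< suc w ℕ.+ n) w+r (ℕP.+-monoʳ-< (suc w) (n%ℕd<d D n))
    open ≡-Reasoning
    representative : + suc w ≡ Y + t * + n
    representative = begin
      + suc w                         ≡⟨ identity₁ (+ suc w) (+ r) ⟩
      (+ suc w + + r) - + r           ≡⟨ cong (_- + r) (trans (sym (ℤP.pos-+ (suc w) r)) (cong +_ w+r)) ⟩
      + Q - + r                       ≡⟨ identity₂ (+ Q) Y (+ r) ⟩
      Y + (D - + r)                   ≡⟨ cong (λ u → Y + (u - + r)) (a≡a%ℕn+[a/ℕn]*n D n) ⟩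
      Y + ((+ r + t * + n) - + r)     ≡⟨ identity₃ Y (+ r) (t * + n) ⟩
      Y + t * + n                     ∎
      where identity₁ : ∀ a b → a ≡ (a + b) - b
            identity₁ = solve-∀
            identity₂ : ∀ Q Y r → Q - r ≡ Y + ((Q - Y) - r)
            identity₂ = solve-∀
            identity₃ : ∀ Y r u → Y + ((r + u) - r) ≡ Y + u
            identity₃ = solve-∀

  between-neighbours : ∀ {y₀ y₁ z} → y₀ ℚ.< y₁ → y₁ ℚ.< z →
                       ↥ z * ↧ y₀ - ↥ y₀ * ↧ z ≡ 1ℤ → ↧ y₀ + ↧ z ≤ ↧ y₁
  between-neighbours {y₀} {y₁} {z} y₀<y₁ y₁<z det =
    ≤-by (u + v) slack (0≤+ (0≤* (0≤↧ y₀) (slack< (ℚP.drop-*<* y₁<z)))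
                            (0≤* (0≤↧ z) (slack< (ℚP.drop-*<* y₀<y₁))))
    where
    open ≡-Reasoning
    a = ↥ y₀ ; b = ↧ y₀ ; c = ↥ y₁ ; d = ↧ y₁ ; e = ↥ z ; f = ↧ z
    u = b * (e * d - c * f - 1ℤ)
    v = f * (c * b - a * d - 1ℤ)
    expand : ∀ a b c d e f → d - (b + f) ≡
             b * (e * d - c * f - 1ℤ) + f * (c * b - a * d - 1ℤ) + d * (1ℤ - (e * b - a * f))
    expand = solve-∀
    vanish : ∀ u v d → u + v + d * (1ℤ - 1ℤ) ≡ u + v
    vanish = solve-∀
    slack : d - (b + f) ≡ u + v
    slack = begin
      d - (b + f)                         ≡⟨ expand a b c d e f ⟩
      u + v + d * (1ℤ - (e * b - a * f))  ≡⟨ cong (λ D → u + v + d * (1ℤ - D)) det ⟩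
      u + v + d * (1ℤ - 1ℤ)               ≡⟨ vanish u v d ⟩
      u + v                               ∎

  -- The fraction z = X/d with
  -- X ↧y₀ - ↥y₀ d = 1 and d ∈ (Q - ↧y₀, Q] lies above y₀ with denominator ≤ Q,
  -- so y₁ ≤ z, while y₁ < z would force ↧y₁ ≥ ↧y₀ + d > Q; hence y₁ = z.
  neighbours : ∀ {Q y₀ y₁} → ↧ y₀ ≤ + Q → ↧ y₁ ≤ + Q → Consecutive Q y₀ y₁ →
               (↥ y₁ * ↧ y₀ - ↥ y₀ * ↧ y₁ ≡ 1ℤ) × (+ Q < ↧ y₀ + ↧ y₁)
  neighbours {Q} {y₀@(mkℚ a n₀ c₀)} {y₁} (+≤+ n≤Q) ↧y₁≤Q cons
    with bezout a (suc n₀) (C.recompute c₀)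
  ... | X , Y , bez with window-representative Y (suc n₀) Q n≤Q
  ... | w , t , rep , w≤Q , Q<w+n =
    subst (λ y → (↥ y * + n - a * ↧ y ≡ 1ℤ) × (+ Q < + n + ↧ y)) (sym y₁≡z)
          (det , subst (λ m → + Q < + m) (ℕP.+-comm (suc w) n) (+<+ Q<w+n))
    where
    open Consecutive cons
    open ≡-Reasoning
    n = suc n₀
    X′ = X + t * a
    det : X′ * + n - a * + suc w ≡ 1ℤ
    det = begin
      X′ * + n - a * + suc w                 ≡⟨ cong (λ d → X′ * + n - a * d) rep ⟩
      (X + t * a) * + n - a * (Y + t * + n)  ≡⟨ shift X Y t a (+ n) ⟩
      X * + n - a * Y                        ≡⟨ bez ⟩
      1ℤ                                     ∎
      where shift : ∀ X Y t a n → (X + t * a) * n - a * (Y + t * n) ≡ X * n - a * Y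
            shift = solve-∀
    z : ℚ
    z = mkℚ X′ w (bezout⇒coprime X′ (+ suc w) (+ n) a det)
    y₀<z : y₀ ℚ.< z
    y₀<z = *<* (<-by 0ℤ (cong (_- 1ℤ) det) ℤP.≤-refl)
    too-large : ↧ y₀ + ↧ z ≤ ↧ y₁ → ⊥
    too-large n+w≤ = ℤP.<-irrefl refl (ℤP.<-≤-trans (+<+ Q<w+n)
      (subst (_≤ + Q) (ℤP.+-comm (+ n) (+ suc w)) (ℤP.≤-trans n+w≤ ↧y₁≤Q)))
    y₁≡z : y₁ ≡ z
    y₁≡z = ℚP.≤-antisym
      (ℚP.≮⇒≥ λ z<y₁ → no-between z (+≤+ w≤Q) y₀<z z<y₁)
      (ℚP.≮⇒≥ λ y₁<z → too-large (between-neighbours increasing y₁<z det))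

module SortedLists where
  open import Defs using (nth)
  open import Data.Nat as ℕ using (ℕ; zero; suc; z≤n; s≤s)
  import Data.Nat.Properties as ℕP
  open import Data.Rational using (ℚ; _<_; _≤_)
  import Data.Rational.Properties as ℚP
  open import Data.List using (List; _∷_; length)
  open import Data.List.Membership.Propositional using (_∈_)
  open import Data.List.Relation.Unary.Any using (here; there)
  import Data.List.Relation.Unary.All as All
  open import Data.List.Relation.Unary.AllPairs using (AllPairs; _∷_)
  open import Data.Product using (Σ; _×_; _,_)
  open import Data.Sum using (inj₁; inj₂)
  open import Data.Empty using (⊥)
  open import Relation.Nullary using (yes; no)
  open import Relation.Binary.PropositionalEquality

  nth-∈ : ∀ (xs : List ℚ) {r} → r ℕ.< length xs → nth xs r ∈ xs
  nth-∈ (x ∷ xs) {zero}  _       = here refl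
  nth-∈ (x ∷ xs) {suc r} (s≤s p) = there (nth-∈ xs p)

  ∈⇒nth : ∀ {xs : List ℚ} {x} → x ∈ xs → Σ ℕ λ s → (s ℕ.< length xs) × (nth xs s ≡ x)
  ∈⇒nth (here refl) = zero , s≤s z≤n , refl
  ∈⇒nth (there x∈) with ∈⇒nth x∈
  ... | s , s<n , eq = suc s , s≤s s<n , eq

  nth-< : ∀ {xs} → AllPairs _<_ xs → ∀ {r s} → r ℕ.< s → s ℕ.< length xs → nth xs r < nth xs s
  nth-< {x ∷ xs} (x< ∷ _)  {zero}  {suc s} _         (s≤s s<n) = All.lookup x< (nth-∈ xs s<n)
  nth-< {x ∷ xs} (_ ∷ inc) {suc r} {suc s} (s≤s r<s) (s≤s s<n) = nth-< inc r<s s<n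

  nth-≤ : ∀ {xs} → AllPairs _<_ xs → ∀ {r s} → r ℕ.≤ s → s ℕ.< length xs → nth xs r ≤ nth xs s
  nth-≤ inc r≤s s<n with ℕP.m≤n⇒m<n∨m≡n r≤s
  ... | inj₁ r<s  = ℚP.<⇒≤ (nth-< inc r<s s<n)
  ... | inj₂ refl = ℚP.≤-refl

  ≤-<-absurd : ∀ {u v : ℚ} → u ≤ v → v < u → ⊥
  ≤-<-absurd u≤v v<u = ℚP.<-irrefl refl (ℚP.≤-<-trans u≤v v<u)

  not-between : ∀ {xs x} → AllPairs _<_ xs → x ∈ xs → ∀ r → suc r ℕ.< length xs →
                nth xs r < x → x < nth xs (suc r) → ⊥
  not-between {xs} inc x∈ r r+1<n below above with ∈⇒nth x∈
  ... | s , s<n , refl with s ℕ.≤? r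
  ...   | yes s≤r = ≤-<-absurd (nth-≤ inc s≤r (ℕP.<⇒≤ r+1<n)) below
  ...   | no  s≰r = ≤-<-absurd (nth-≤ inc (ℕP.≰⇒> s≰r) s<n) above

  not-below-first : ∀ {xs x} → AllPairs _<_ xs → x ∈ xs → x < nth xs 0 → ⊥
  not-below-first inc x∈ below with ∈⇒nth x∈
  ... | s , s<n , refl = ≤-<-absurd (nth-≤ inc z≤n s<n) below

  not-above-last : ∀ {xs x} → AllPairs _<_ xs → x ∈ xs → ∀ r → suc r ≡ length xs →
                   nth xs r < x → ⊥
  not-above-last inc x∈ r r+1≡n above with ∈⇒nth x∈
  ... | s , s<n , refl = ≤-<-absurd (nth-≤ inc (ℕP.≤-pred (subst (s ℕ.<_) (sym r+1≡n) s<n))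
                                         (subst (r ℕ.<_) r+1≡n ℕP.≤-refl)) above

module FareyList where
  open import Defs using (fracsOfDen; farey)
  open import Data.Bool using (T)
  open import Data.Nat as ℕ using (ℕ; zero; suc; z≤n; s≤s; _≡ᵇ_)
  import Data.Nat.Properties as ℕP
  open import Data.Nat.GCD using (gcd)
  open import Data.Nat.Coprimality as C using (Coprime)
  open import Data.Integer as ℤ using (ℤ; +_; -[1+_]; +≤+; +<+)
  import Data.Integer.Properties as ℤP
  open import Data.Rational as ℚ using (ℚ; mkℚ; ↧_; *<*; *≤*; _<_; _≤_; 0ℚ; 1ℚ)
  import Data.Rational.Properties as ℚP
  import Data.Rational.Unnormalised as ℚᵘ
  open import Data.List using (List; concatMap; applyUpTo; map)
  open import Data.List.Membership.Propositional using (_∈_; find; lose)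
  open import Data.List.Membership.Propositional.Properties
    using (∈-concatMap⁻; ∈-concatMap⁺; ∈-applyUpTo⁻; ∈-applyUpTo⁺; ∈-map∘filter⁻; ∈-map∘filter⁺)
  import Data.List.Relation.Unary.All as All
  import Data.List.Relation.Unary.All.Properties as AllP
  open import Data.List.Relation.Unary.AllPairs as AllPairs using (AllPairs)
  import Data.List.Relation.Unary.AllPairs.Properties as AllPairsP
  open import Data.List.Relation.Unary.Linked.Properties using (Linked⇒AllPairs)
  open import Data.List.Relation.Unary.Unique.Propositional using (Unique)
  import Data.List.Relation.Unary.Unique.Propositional.Properties as UniqueP
  open import Data.List.Relation.Binary.Permutation.Propositional using (↭-sym; ↭⇒↭ₛ)
  open import Data.List.Relation.Binary.Permutation.Propositional.Properties using (∈-resp-↭)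
  import Data.List.Relation.Binary.Permutation.Setoid.Properties as PermutationS
  import Data.List.Sort.MergeSort.Properties
  open import Data.Product using (Σ; _×_; _,_)
  open import Data.Empty using (⊥-elim)
  open import Relation.Nullary using (Dec; yes; no)
  open import Relation.Nullary.Decidable using (T?)
  open import Data.List.Relation.Binary.Disjoint.Propositional using (Disjoint)
  open import Relation.Binary.PropositionalEquality

  module MergeSort = Data.List.Sort.MergeSort.Properties ℚP.≤-decTotalOrder

  candidates : ℕ → List ℚ
  candidates Q = concatMap (λ q → fracsOfDen (suc q)) (applyUpTo (λ q → q) Q)

  Reduced : ℕ → ℕ → Set
  Reduced m a = T (gcd (suc a) (suc m) ≡ᵇ 1)

  reduced? : ∀ m a → Dec (Reduced m a)
  reduced? m a = T? (gcd (suc a) (suc m) ≡ᵇ 1)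

  reduced⇒coprime : ∀ {m a} → Reduced m a → Coprime (suc a) (suc m)
  reduced⇒coprime r = C.gcd≡1⇒coprime (ℕP.≡ᵇ⇒≡ _ _ r)

  fraction : ℕ → ℕ → ℚ
  fraction m a = (+ suc a) ℚ./ suc m

  fraction≡mkℚ : ∀ m a (c : Coprime (suc a) (suc m)) → fraction m a ≡ mkℚ (+ suc a) m c
  fraction≡mkℚ m a c = ℚP.normalize-coprime c

  ∈fracsOfDen⁻ : ∀ {m x} → x ∈ fracsOfDen (suc m) →
                 Σ ℕ λ a → (a ℕ.< suc m) × Σ (Coprime (suc a) (suc m)) λ c → x ≡ mkℚ (+ suc a) m c
  ∈fracsOfDen⁻ {m} x∈ with ∈-map∘filter⁻ (fraction m) (reduced? m) x∈
  ... | a , a∈ , x≡ , red with ∈-applyUpTo⁻ (λ q → q) a∈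
  ... | _ , a<m , refl =
    a , a<m , reduced⇒coprime red , trans x≡ (fraction≡mkℚ m a (reduced⇒coprime red))

  ∈candidates⁻ : ∀ {Q x} → x ∈ candidates Q → Σ ℕ λ m → (m ℕ.< Q) × (x ∈ fracsOfDen (suc m))
  ∈candidates⁻ {Q} x∈ with find (∈-concatMap⁻ (λ q → fracsOfDen (suc q)) {xs = applyUpTo (λ q → q) Q} x∈)
  ... | m , m∈ , x∈′ with ∈-applyUpTo⁻ (λ q → q) m∈
  ... | _ , m<Q , refl = m , m<Q , x∈′

  candidate-bounds : ∀ {Q x} → x ∈ candidates Q → (0ℚ < x) × (x ≤ 1ℚ) × (↧ x ℤ.≤ + Q)
  candidate-bounds {Q} x∈ with ∈candidates⁻ {Q} x∈
  ... | m , m<Q , x∈′ with ∈fracsOfDen⁻ x∈′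
  ... | a , a<m , c , refl = positive , at-most-one , +≤+ m<Q
    where
    positive : 0ℚ < mkℚ (+ suc a) m c
    positive = *<* (+<+ (s≤s z≤n))
    at-most-one : mkℚ (+ suc a) m c ≤ 1ℚ
    at-most-one = *≤* (subst₂ ℤ._≤_ (sym (ℤP.*-identityʳ (+ suc a))) (sym (ℤP.*-identityˡ (+ suc m))) (+≤+ a<m))

  candidate-complete : ∀ {Q} x → 0ℚ < x → x ≤ 1ℚ → ↧ x ℤ.≤ + Q → x ∈ candidates Q
  candidate-complete (mkℚ (+ zero) m c) (*<* (+<+ ())) _ _
  candidate-complete (mkℚ -[1+ k ] m c) (*<* ()) _ _
  candidate-complete {Q} (mkℚ (+ suc a) m c) _ (*≤* x≤1) (+≤+ m<Q) =
    ∈-concatMap⁺ (λ q → fracsOfDen (suc q)) {xs = applyUpTo (λ q → q) Q}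
      (lose (∈-applyUpTo⁺ (λ q → q) m<Q) x∈)
    where
    a<m : a ℕ.< suc m
    a<m with subst₂ ℤ._≤_ (ℤP.*-identityʳ (+ suc a)) (ℤP.*-identityˡ (+ suc m)) x≤1
    ... | +≤+ a<m = a<m
    c′ = C.recompute c
    x∈ : mkℚ (+ suc a) m c ∈ fracsOfDen (suc m)
    x∈ = ∈-map∘filter⁺ (fraction m) (reduced? m)
           (a , ∈-applyUpTo⁺ (λ q → q) a<m , sym (fraction≡mkℚ m a c′) , ℕP.≡⇒≡ᵇ _ _ (C.coprime⇒gcd≡1 c′))

  fraction-injective : ∀ m {a b} → fraction m a ≡ fraction m b → a ≡ b
  fraction-injective m {a} {b} eq with ℚP./-injective-≃ (ℚᵘ.mkℚᵘ (+ suc a) m) (ℚᵘ.mkℚᵘ (+ suc b) m) eq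
  ... | ℚᵘ.*≡* cross = ℕP.suc-injective (ℤP.+-injective (ℤP.*-cancelʳ-≡ (+ suc a) (+ suc b) (+ suc m) cross))

  -- No fraction is listed twice: within one denominator by injectivity, across
  -- denominators because the (reduced) denominators differ.
  fracsOfDen-unique : ∀ m → Unique (fracsOfDen (suc m))
  fracsOfDen-unique m = UniqueP.map⁺ (fraction-injective m)
    (UniqueP.filter⁺ (reduced? m) (UniqueP.upTo⁺ (suc m)))

  fracsOfDen-denominator : ∀ {m x} → x ∈ fracsOfDen (suc m) → ↧ x ≡ + suc m
  fracsOfDen-denominator x∈ with ∈fracsOfDen⁻ x∈
  ... | _ , _ , _ , refl = refl

  candidates-unique : ∀ Q → Unique (candidates Q)
  candidates-unique Q = UniqueP.concat⁺
    (AllP.map⁺ (All.tabulate (λ {m} _ → fracsOfDen-unique m)))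
    (AllPairsP.map⁺ (AllPairs.map disjoint (UniqueP.upTo⁺ Q)))
    where
    disjoint : ∀ {m m′} → m ≢ m′ → Disjoint (fracsOfDen (suc m)) (fracsOfDen (suc m′))
    disjoint m≢m′ (x∈ , x∈′) =
      m≢m′ (ℕP.suc-injective (ℤP.+-injective (trans (sym (fracsOfDen-denominator x∈)) (fracsOfDen-denominator x∈′))))

  ≤∧≢⇒< : ∀ {p q : ℚ} → p ≤ q → p ≢ q → p < q
  ≤∧≢⇒< {p} {q} p≤q p≢q with p ℚP.<? q
  ... | yes p<q = p<q
  ... | no  p≮q = ⊥-elim (p≢q (ℚP.≤-antisym p≤q (ℚP.≮⇒≥ p≮q)))

  farey-increasing : ∀ Q → AllPairs _<_ (farey Q)
  farey-increasing Q = AllPairs.zipWith (λ (p≤q , p≢q) → ≤∧≢⇒< p≤q p≢q)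
    ( Linked⇒AllPairs ℚP.≤-trans (MergeSort.sort-↗ (candidates Q))
    , PermutationS.Unique-resp-↭ (setoid ℚ) (↭⇒↭ₛ (↭-sym (MergeSort.sort-↭ (candidates Q)))) (candidates-unique Q))

  farey-bounds : ∀ {Q x} → x ∈ farey Q → (0ℚ < x) × (x ≤ 1ℚ) × (↧ x ℤ.≤ + Q)
  farey-bounds {Q} x∈ = candidate-bounds {Q} (∈-resp-↭ (MergeSort.sort-↭ (candidates Q)) x∈)

  farey-complete : ∀ {Q} x → 0ℚ < x → x ≤ 1ℚ → ↧ x ℤ.≤ + Q → x ∈ farey Q
  farey-complete {Q} x 0<x x≤1 ↧x≤Q =
    ∈-resp-↭ (↭-sym (MergeSort.sort-↭ (candidates Q))) (candidate-complete x 0<x x≤1 ↧x≤Q)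

module Extension where
  open import Defs using (nth; extend)
  open IntegerArithmetic
  open Fractions
  open SortedLists
  open import Data.Nat as ℕ using (ℕ; suc; s≤s; z≤n)
  import Data.Nat.Properties as ℕP
  open import Data.Integer as ℤ using (ℤ; +_; _*_; 0ℤ; 1ℤ; +≤+; +<+)
  import Data.Integer.Properties as ℤP
  open import Data.Integer.DivMod using (_%ℕ_; _/ℕ_; n%ℕd<d; a≡a%ℕn+[a/ℕn]*n)
  open import Data.Integer.Tactic.RingSolver using (solve-∀)
  open import Data.Rational as ℚ using (ℚ; ↧_; _<_; _≤_; _+_; _-_; 0ℚ; 1ℚ)
  import Data.Rational.Properties as ℚP
  open import Data.List using (List; []; _∷_; length)
  open import Data.List.Membership.Propositional using (_∈_)
  open import Data.List.Relation.Unary.Any using (here)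
  open import Data.List.Relation.Unary.AllPairs using (AllPairs)
  open import Data.Product using (_×_; _,_; proj₁; proj₂)
  open import Data.Sum using (inj₁; inj₂)
  open import Data.Empty using (⊥)
  open import Relation.Nullary using (yes; no)
  open import Relation.Binary.PropositionalEquality

  record Enumerates (Q : ℕ) (xs : List ℚ) : Set where
    field
      increasing : AllPairs _<_ xs
      bounds     : ∀ {x} → x ∈ xs → (0ℚ < x) × (x ≤ 1ℚ) × (↧ x ℤ.≤ + Q)
      complete   : ∀ x → 0ℚ < x → x ≤ 1ℚ → ↧ x ℤ.≤ + Q → x ∈ xs

  module PeriodicExtension {Q : ℕ} {y : ℚ} {ys : List ℚ} (E : Enumerates Q (y ∷ ys)) where
    open Enumerates E

    xs = y ∷ ys
    N  = length xs

    entry-bounds : ∀ {r} → r ℕ.< N → (0ℚ < nth xs r) × (nth xs r ≤ 1ℚ) × (↧ nth xs r ℤ.≤ + Q)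
    entry-bounds r<N = bounds (nth-∈ xs r<N)

    adjacent-consecutive : ∀ r → suc r ℕ.< N → Consecutive Q (nth xs r) (nth xs (suc r))
    adjacent-consecutive r r+1<N = record
      { increasing = nth-< increasing (ℕP.n<1+n r) r+1<N
      ; no-between = λ z ↧z≤Q below above → not-between increasing
          (complete z (ℚP.<-trans (proj₁ (entry-bounds (ℕP.<⇒≤ r+1<N))) below)
                      (ℚP.<⇒≤ (ℚP.<-≤-trans above (proj₁ (proj₂ (entry-bounds r+1<N))))) ↧z≤Q)
          r r+1<N below above
      }

    wrap-consecutive : ∀ r → suc r ≡ N → Consecutive Q (nth xs r) (y + integer 1ℤ)
    wrap-consecutive r r+1≡N = record
      { increasing = ℚP.≤-<-trans (proj₁ (proj₂ last-bounds)) 1<y+1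
      ; no-between = no-between
      }
      where
      last-bounds = entry-bounds (subst (r ℕ.<_) r+1≡N ℕP.≤-refl)
      0<y = proj₁ (bounds (here refl))
      1<y+1 : 1ℚ < y + integer 1ℤ
      1<y+1 = subst (_< y + integer 1ℤ) (ℚP.+-identityˡ 1ℚ) (ℚP.+-monoˡ-< 1ℚ 0<y)
      no-between : ∀ z → ↧ z ℤ.≤ + Q → nth xs r < z → z < y + integer 1ℤ → ⊥
      no-between z ↧z≤Q below above with z ℚP.≤? 1ℚ
      ... | yes z≤1 = not-above-last increasing
            (complete z (ℚP.<-trans (proj₁ last-bounds) below) z≤1 ↧z≤Q) r r+1≡N below
      ... | no  z≰1 = not-below-first increasing
            (complete (z - 1ℚ) 0<z-1 (ℚP.<⇒≤ (ℚP.<-≤-trans z-1<y (proj₁ (proj₂ (bounds (here refl))))))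
                      (ℤP.≤-trans (↧-+integral z (ℚ.- 1ℚ) refl) ↧z≤Q))
            z-1<y
        where
        0<z-1 : 0ℚ < z - 1ℚ
        0<z-1 = subst (_< z - 1ℚ) (ℚP.+-inverseʳ 1ℚ) (ℚP.+-monoˡ-< (ℚ.- 1ℚ) (ℚP.≰⇒> z≰1))
        z-1<y : z - 1ℚ < y
        z-1<y = subst (z - 1ℚ <_) (+-cancelʳ y 1ℚ) (ℚP.+-monoˡ-< (ℚ.- 1ℚ) above)

    position : ℤ → ℚ
    position j = nth xs (j %ℕ N) + integer (j /ℕ N)

    extend≡position : ∀ i → extend xs i ≡ position (i ℤ.- 1ℤ)
    extend≡position i = cong (λ u → nth xs ((i ℤ.- 1ℤ) %ℕ N) + u) (/1≡integer ((i ℤ.- 1ℤ) /ℕ N))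

    position-denominator : ∀ j → ↧ position j ℤ.≤ + Q
    position-denominator j =
      ℤP.≤-trans (↧-+integral (nth xs (j %ℕ N)) (integer (j /ℕ N)) refl) (proj₂ (proj₂ (entry-bounds (n%ℕd<d j N))))

    step-within : ∀ j → suc (j %ℕ N) ℕ.< N →
                  ((j ℤ.+ 1ℤ) %ℕ N ≡ suc (j %ℕ N)) × ((j ℤ.+ 1ℤ) /ℕ N ≡ j /ℕ N)
    step-within j r+1<N = divmod-unique N (n%ℕd<d (j ℤ.+ 1ℤ) N) r+1<N
      (trans (sym (a≡a%ℕn+[a/ℕn]*n (j ℤ.+ 1ℤ) N))
             (trans (cong (ℤ._+ 1ℤ) (a≡a%ℕn+[a/ℕn]*n j N)) (regroup (+ (j %ℕ N)) (j /ℕ N) (+ N))))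
      where regroup : ∀ r t N → r ℤ.+ t * N ℤ.+ 1ℤ ≡ 1ℤ ℤ.+ r ℤ.+ t * N
            regroup = solve-∀

    step-wrap : ∀ j → suc (j %ℕ N) ≡ N →
                ((j ℤ.+ 1ℤ) %ℕ N ≡ 0) × ((j ℤ.+ 1ℤ) /ℕ N ≡ j /ℕ N ℤ.+ 1ℤ)
    step-wrap j r+1≡N = divmod-unique N (n%ℕd<d (j ℤ.+ 1ℤ) N) (s≤s z≤n)
      (trans (sym (a≡a%ℕn+[a/ℕn]*n (j ℤ.+ 1ℤ) N))
      (trans (cong (ℤ._+ 1ℤ) (a≡a%ℕn+[a/ℕn]*n j N))
      (trans (regroup (+ (j %ℕ N)) (j /ℕ N) (+ N))
      (trans (cong (λ u → u ℤ.+ j /ℕ N * + N) (cong +_ r+1≡N)) (regroup′ (j /ℕ N) (+ N))))))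
      where regroup : ∀ r t N → r ℤ.+ t * N ℤ.+ 1ℤ ≡ (1ℤ ℤ.+ r) ℤ.+ t * N
            regroup = solve-∀
            regroup′ : ∀ t N → N ℤ.+ t * N ≡ 0ℤ ℤ.+ (t ℤ.+ 1ℤ) * N
            regroup′ = solve-∀

    position-consecutive : ∀ j → Consecutive Q (position j) (position (j ℤ.+ 1ℤ))
    position-consecutive j with ℕP.m≤n⇒m<n∨m≡n (n%ℕd<d j N)
    ... | inj₁ r+1<N = subst (Consecutive Q (position j)) (sym next≡)
                             (consecutive-+integer (j /ℕ N) (adjacent-consecutive (j %ℕ N) r+1<N))
      where next≡ : position (j ℤ.+ 1ℤ) ≡ nth xs (suc (j %ℕ N)) + integer (j /ℕ N)
            next≡ = cong₂ (λ r t → nth xs r + integer t) (proj₁ (step-within j r+1<N)) (proj₂ (step-within j r+1<N))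
    ... | inj₂ r+1≡N = subst (Consecutive Q (position j)) (sym next≡)
                             (consecutive-+integer t (wrap-consecutive (j %ℕ N) r+1≡N))
      where
      t = j /ℕ N
      open ≡-Reasoning
      next≡ : position (j ℤ.+ 1ℤ) ≡ y + integer 1ℤ + integer t
      next≡ = begin
        position (j ℤ.+ 1ℤ)                 ≡⟨ cong₂ (λ r t → nth xs r + integer t)
                                                     (proj₁ (step-wrap j r+1≡N)) (proj₂ (step-wrap j r+1≡N)) ⟩
        y + integer (t ℤ.+ 1ℤ)              ≡⟨ cong (λ u → y + u) (integer-+ t 1ℤ) ⟩
        y + (integer t + integer 1ℤ)        ≡⟨ cong (λ u → y + u) (ℚP.+-comm (integer t) (integer 1ℤ)) ⟩
        y + (integer 1ℤ + integer t)        ≡⟨ sym (ℚP.+-assoc y (integer 1ℤ) (integer t)) ⟩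
        y + integer 1ℤ + integer t          ∎

    extend-consecutive : ∀ m → Consecutive Q (extend xs m) (extend xs (m ℤ.+ 1ℤ))
    extend-consecutive m =
      subst₂ (Consecutive Q) (sym (extend≡position m))
             (sym (trans (extend≡position (m ℤ.+ 1ℤ)) (cong position (reindex m))))
             (position-consecutive (m ℤ.- 1ℤ))
      where reindex : ∀ m → m ℤ.+ 1ℤ ℤ.- 1ℤ ≡ m ℤ.- 1ℤ ℤ.+ 1ℤ
            reindex = solve-∀

    extend-denominator : ∀ m → ↧ extend xs m ℤ.≤ + Q
    extend-denominator m = subst (λ u → ↧ u ℤ.≤ + Q) (sym (extend≡position m)) (position-denominator (m ℤ.- 1ℤ))

  extension-properties : ∀ {Q xs} → 1 ℕ.≤ Q → Enumerates Q xs → ∀ m →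
                         (↧ extend xs m ℤ.≤ + Q) × Consecutive Q (extend xs m) (extend xs (m ℤ.+ 1ℤ))
  extension-properties {Q} {[]} 1≤Q E m with Enumerates.complete E 1ℚ (ℚ.*<* (+<+ (s≤s z≤n))) ℚP.≤-refl (+≤+ 1≤Q)
  ... | ()
  extension-properties {Q} {y ∷ ys} 1≤Q E m = extend-denominator m , extend-consecutive m
    where open PeriodicExtension E

module FareySequence where
  open import Defs
  open IntegerArithmetic
  open WindowRecurrence
  open Fractions
  open FareyNeighbours
  open FareyList
  open Extension
  open import Data.Nat as ℕ using (ℕ; suc; s≤s; z≤n)
  open import Data.Integer as ℤ using (ℤ; +_; _+_; _-_; _*_; 0ℤ; 1ℤ; +≤+)
  import Data.Integer.Properties as ℤP
  open import Data.Integer.Tactic.RingSolver using (solve-∀)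
  open import Data.Product using (_×_; _,_; proj₁; proj₂)
  open import Function using (_∘_)
  open import Relation.Binary.PropositionalEquality

  farey-enumerates : ∀ Q → Enumerates Q (farey Q)
  farey-enumerates Q = record
    { increasing = farey-increasing Q
    ; bounds     = farey-bounds
    ; complete   = farey-complete
    }

  module FareyDenominators (Q : ℕ) (1≤Q : 1 ℕ.≤ Q) where

    denominator-bound : ∀ m → q Q m ℤ.≤ + Q
    denominator-bound m = proj₁ (extension-properties 1≤Q (farey-enumerates Q) m)

    consecutive-terms : ∀ m → (a Q (m + 1ℤ) * q Q m - a Q m * q Q (m + 1ℤ) ≡ 1ℤ) × (+ Q ℤ.< q Q m + q Q (m + 1ℤ))
    consecutive-terms m = neighbours (denominator-bound m) (denominator-bound (m + 1ℤ))
                                     (proj₂ (extension-properties 1≤Q (farey-enumerates Q) m))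

    index-recurrence : ∀ m → ν₂ Q m * q Q m ≡ q Q (m - 1ℤ) + q Q (m + 1ℤ)
    index-recurrence m = ℤP.i-j≡0⇒i≡j _ _ (begin
      ν₂ Q m * q Q m - (q₋ + q₊)
        ≡⟨ expand a₊ a₀ a₋ q₊ q₀ q₋ ⟩
      q₋ * (a₊ * q₀ - a₀ * q₊ - 1ℤ) + q₊ * (a₀ * q₋ - a₋ * q₀ - 1ℤ)
        ≡⟨ cong₂ (λ u v → q₋ * (u - 1ℤ) + q₊ * (v - 1ℤ)) (proj₁ (consecutive-terms m)) previous ⟩
      q₋ * (1ℤ - 1ℤ) + q₊ * (1ℤ - 1ℤ)
        ≡⟨ vanish q₋ q₊ ⟩
      0ℤ ∎)
      where
      open ≡-Reasoning
      a₊ = a Q (m + 1ℤ) ; a₀ = a Q m ; a₋ = a Q (m - 1ℤ)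
      q₊ = q Q (m + 1ℤ) ; q₀ = q Q m ; q₋ = q Q (m - 1ℤ)
      expand : ∀ a₊ a₀ a₋ q₊ q₀ q₋ → (a₊ * q₋ - a₋ * q₊) * q₀ - (q₋ + q₊) ≡
               q₋ * (a₊ * q₀ - a₀ * q₊ - 1ℤ) + q₊ * (a₀ * q₋ - a₋ * q₀ - 1ℤ)
      expand = solve-∀
      vanish : ∀ x y → x * (1ℤ - 1ℤ) + y * (1ℤ - 1ℤ) ≡ 0ℤ
      vanish = solve-∀
      reindex : ∀ m → m - 1ℤ + 1ℤ ≡ m
      reindex = solve-∀
      previous : a₀ * q₋ - a₋ * q₀ ≡ 1ℤ
      previous = subst (λ u → a Q u * q₋ - a₋ * q Q u ≡ 1ℤ) (reindex m) (proj₁ (consecutive-terms (m - 1ℤ)))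

    positive : ∀ m → 1ℤ ℤ.≤ q Q m
    positive m = +≤+ (s≤s z≤n)

    ascending-walk : (f : ℕ → ℤ) → (∀ j → f (suc j) ≡ f j + 1ℤ) →
                     IsRecurrence (+ Q) (q Q ∘ f) (ν₂ Q ∘ f)
    ascending-walk f step = record
      { positive   = positive ∘ f
      ; bounded    = denominator-bound ∘ f
      ; adjacent   = λ j → subst (λ u → + Q ℤ.< q Q (f j) + q Q u) (sym (step j)) (proj₂ (consecutive-terms (f j)))
      ; recurrence = λ j → subst₂ (λ u v → ν₂ Q (f (suc j)) * q Q (f (suc j)) ≡ q Q u + q Q v)
                                  (back j) (sym (step (suc j))) (index-recurrence (f (suc j)))
      }
      where back : ∀ j → f (suc j) - 1ℤ ≡ f j
            back j = trans (cong (_- 1ℤ) (step j)) (cancel (f j))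
              where cancel : ∀ m → m + 1ℤ - 1ℤ ≡ m
                    cancel = solve-∀

    descending-walk : (f : ℕ → ℤ) → (∀ j → f j ≡ f (suc j) + 1ℤ) →
                      IsRecurrence (+ Q) (q Q ∘ f) (ν₂ Q ∘ f)
    descending-walk f step = record
      { positive   = positive ∘ f
      ; bounded    = denominator-bound ∘ f
      ; adjacent   = λ j → subst (λ u → + Q ℤ.< u) (ℤP.+-comm (q Q (f (suc j))) (q Q (f j)))
                             (subst (λ u → + Q ℤ.< q Q (f (suc j)) + q Q u) (sym (step j))
                                    (proj₂ (consecutive-terms (f (suc j)))))
      ; recurrence = λ j → trans (subst₂ (λ u v → ν₂ Q (f (suc j)) * q Q (f (suc j)) ≡ q Q u + q Q v)
                                         (back j) (sym (step j)) (index-recurrence (f (suc j))))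
                                 (ℤP.+-comm (q Q (f (suc (suc j)))) (q Q (f j)))
      }
      where back : ∀ j → f (suc j) - 1ℤ ≡ f (suc (suc j))
            back j = trans (cong (_- 1ℤ) (step (suc j))) (cancel (f (suc (suc j))))
              where cancel : ∀ m → m + 1ℤ - 1ℤ ≡ m
                    cancel = solve-∀

    upwards : ∀ k → 1 ℕ.≤ k → ∀ i → + 4 * + k + 1ℤ ℤ.≤ ν₂ Q i →
              (ν₂ Q (i + + 1) ≡ + 1) × (∀ j → 2 ℕ.≤ j → j ℕ.≤ k → ν₂ Q (i + + j) ≡ + 2)
    upwards k 1≤k i ν≥ =
      subst (λ m → ν₂ Q m ≡ + 1) (index 1) (proj₁ multipliers) ,
      λ j 2≤j j≤k → subst (λ m → ν₂ Q m ≡ + 2) (index j) (proj₂ multipliers j 2≤j j≤k)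
      where
      walk : ℕ → ℤ
      walk j = i - 1ℤ + + j
      index : ∀ j → walk (suc j) ≡ i + + j
      index j = shift i (+ j)
        where shift : ∀ i J → i - 1ℤ + (1ℤ + J) ≡ i + J
              shift = solve-∀
      step : ∀ j → walk (suc j) ≡ walk j + 1ℤ
      step j = shift i (+ j)
        where shift : ∀ i J → i - 1ℤ + (1ℤ + J) ≡ i - 1ℤ + J + 1ℤ
              shift = solve-∀
      open LargeMultiplier (ascending-walk walk step) k 1≤k
        (subst (λ m → + 4 * + k + 1ℤ ℤ.≤ ν₂ Q m) (sym (trans (index 0) (ℤP.+-identityʳ i))) ν≥)

    downwards : ∀ k → 1 ℕ.≤ k → ∀ i → + 4 * + k + 1ℤ ℤ.≤ ν₂ Q i →
                (ν₂ Q (i - + 1) ≡ + 1) × (∀ j → 2 ℕ.≤ j → j ℕ.≤ k → ν₂ Q (i - + j) ≡ + 2)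
    downwards k 1≤k i ν≥ =
      subst (λ m → ν₂ Q m ≡ + 1) (index 1) (proj₁ multipliers) ,
      λ j 2≤j j≤k → subst (λ m → ν₂ Q m ≡ + 2) (index j) (proj₂ multipliers j 2≤j j≤k)
      where
      walk : ℕ → ℤ
      walk j = i + 1ℤ - + j
      index : ∀ j → walk (suc j) ≡ i - + j
      index j = shift i (+ j)
        where shift : ∀ i J → i + 1ℤ - (1ℤ + J) ≡ i - J
              shift = solve-∀
      step : ∀ j → walk j ≡ walk (suc j) + 1ℤ
      step j = shift i (+ j)
        where shift : ∀ i J → i + 1ℤ - J ≡ i + 1ℤ - (1ℤ + J) + 1ℤ
              shift = solve-∀
      open LargeMultiplier (descending-walk walk step) k 1≤k
        (subst (λ m → + 4 * + k + 1ℤ ℤ.≤ ν₂ Q m) (sym (trans (index 0) (ℤP.+-identityʳ i))) ν≥)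

open import Defs
open import Data.Nat using (ℕ; _≤_; _*_; _+_)
open import Data.Integer as ℤ using (ℤ; +_)
open import Data.Integer.Properties using (pos-+; pos-*)
open import Data.Product using (_×_; _,_; proj₁; proj₂)
open import Relation.Binary.PropositionalEquality
open FareySequence using (module FareyDenominators)

lemma1 : (Q : ℕ) → 1 ≤ Q → (k : ℕ) → 1 ≤ k → (i : ℤ) →
    + (4 * k + 1) ℤ.≤ ν₂ Q i →
    (ν₂ Q (i ℤ.+ + 1) ≡ + 1) × (ν₂ Q (i ℤ.- + 1) ≡ + 1) ×
    ((j : ℕ) → 2 ≤ j → j ≤ k →
    (ν₂ Q (i ℤ.+ + j) ≡ + 2) × (ν₂ Q (i ℤ.- + j) ≡ + 2))
lemma1 Q 1≤Q k 1≤k i ν≥ =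
  proj₁ up , proj₁ down , λ j 2≤j j≤k → proj₂ up j 2≤j j≤k , proj₂ down j 2≤j j≤k
  where
  open FareyDenominators Q 1≤Q
  ν≥′ : + 4 ℤ.* + k ℤ.+ ℤ.1ℤ ℤ.≤ ν₂ Q i
  ν≥′ = subst (ℤ._≤ ν₂ Q i) (trans (pos-+ (4 * k) 1) (cong (ℤ._+ ℤ.1ℤ) (pos-* 4 k))) ν≥
  up   = upwards k 1≤k i ν≥′
  down = downwards k 1≤k i ν≥′
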